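{- Let $\alpha_{p,q}$ denote the number of signed $(p,q)$-involutions. Then $\alpha_{p,0}=\alpha_{0,q}=1$ for all nonnegative integers $p,q$, and for all $p,q\ge1$, $$\alpha_{p,q}=\alpha_{p-1,q}+\alpha_{p,q-1}+(p+q-1)\,\alpha_{p-1,q-1}.$$
   Context: Let $p,q\ge 0$ be integers and $n=p+q$. A signed $(p,q)$-involution is an involution $\pi$ of $\{1,\dots,n\}$ together with an assignment of a sign $+$ or $-$ to each fixed point of $\pi$, such that (number of $+$ signs) $-$ (number of $-$ signs) $=p-q$. $\alpha_{p,q}$ is the total number of signed $(p,q)$-involutions (these parametrize the $S(GL_p\times GL_q)$-orbits on the flag variety of $SL_n$). -}

module Defs where

open import Data.Nat using (ℕ; zero; suc; _+_)
open import Data.Fin using (Fin)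
open import Data.Fin.Properties using (all?) renaming (_≟_ to _≟ᶠ_)
open import Data.Integer using (ℤ; +_; _-_) renaming (_≟_ to _≟ᶻ_)
open import Data.List using (List; []; _∷_; map; concatMap; filter; length; allFin)
open import Data.Vec using (Vec; []; _∷_; lookup)
open import Data.Sum using (_⊎_; inj₁; inj₂)
open import Data.Sum.Properties using (≡-dec)
open import Data.Product using (_×_)
open import Relation.Binary.PropositionalEquality using (_≡_; _≢_; refl)
open import Relation.Nullary using (Dec; yes; no; ¬?)
open import Relation.Nullary.Decidable using (_×-dec_; _→-dec_)

data Sign : Set where
  plus minus : Sign

_≟ˢ_ : (a b : Sign) → Dec (a ≡ b)
plus  ≟ˢ plus  = yes refl
plus  ≟ˢ minus = no λ ()
minus ≟ˢ plus  = no λ ()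
minus ≟ˢ minus = yes refl

-- Encoding of an involution of {1..n} (as Fin n) together with signs on
-- its fixed points: entry i is  inj₁ j  if π(i) = j ≠ i, and  inj₂ s  if
-- π(i) = i and i carries sign s.
Code : ℕ → Set
Code n = Vec (Fin n ⊎ Sign) n

IsInvolutionCode : ∀ {n} → Code n → Set
IsInvolutionCode {n} v =
  ∀ (i j : Fin n) → lookup v i ≡ inj₁ j → (j ≢ i × lookup v j ≡ inj₁ i)

#sign : ∀ {n} → Sign → Code n → ℕ
#sign {n} s v = length (filter (λ i → ≡-dec _≟ᶠ_ _≟ˢ_ (lookup v i) (inj₂ s)) (allFin n))

IsSignedInvolution : (p q : ℕ) → Code (p + q) → Set
IsSignedInvolution p q v =
  IsInvolutionCode v × (+ #sign plus v - + #sign minus v ≡ + p - + q)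

isInvolutionCode? : ∀ {n} (v : Code n) → Dec (IsInvolutionCode v)
isInvolutionCode? {n} v =
  all? λ i → all? λ j →
    ≡-dec _≟ᶠ_ _≟ˢ_ (lookup v i) (inj₁ j) →-dec
      (¬? (j ≟ᶠ i) ×-dec ≡-dec _≟ᶠ_ _≟ˢ_ (lookup v j) (inj₁ i))

isSignedInvolution? : (p q : ℕ) (v : Code (p + q)) → Dec (IsSignedInvolution p q v)
isSignedInvolution? p q v =
  isInvolutionCode? v ×-dec (+ #sign plus v - + #sign minus v ≟ᶻ + p - + q)

allVecs : ∀ {A : Set} → List A → (m : ℕ) → List (Vec A m)
allVecs xs zero    = [] ∷ []
allVecs xs (suc m) = concatMap (λ x → map (x ∷_) (allVecs xs m)) xs

allSignedEntries : (n : ℕ) → List (Fin n ⊎ Sign)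
allSignedEntries n = map inj₁ (allFin n) Data.List.++ (inj₂ plus ∷ inj₂ minus ∷ [])

allCodes : (n : ℕ) → List (Code n)
allCodes n = allVecs (allSignedEntries n) n

α : ℕ → ℕ → ℕ
α p q = length (filter (isSignedInvolution? p q) (allCodes (p + q)))

module Submission where

open import Defs
open import Data.Nat using (ℕ; suc; _+_; _*_)
open import Data.Product using (_×_)
open import Relation.Binary.PropositionalEquality using (_≡_)

open import Data.Empty using (⊥; ⊥-elim)
open import Data.Fin using (Fin; zero; suc; toℕ; fromℕ<)
open import Data.Fin.Properties using (toℕ-injective; toℕ<n; toℕ-fromℕ<)
  renaming (_≟_ to _≟ᶠ_; suc-injective to Fin-suc-injective)
open import Data.Integer as ℤ using (ℤ; +_; -[1+_]; -_; _-_; 0ℤ; 1ℤ; -1ℤ)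
open import Data.Integer.Properties using (suc-pred; pred-suc) renaming (+-identityˡ to ℤ-+-identityˡ)
import Data.Integer.Tactic.RingSolver as ℤ-Solver
open import Data.List using (List; []; _∷_; _++_; map; concatMap; filter; length; tabulate; allFin)
open import Data.List.Properties using (filter-++; length-++; filter-none; map-tabulate; map-cong; map-++; map-∘)
open import Data.List.Relation.Unary.All using (universal)
open import Data.Maybe using (Maybe; just; nothing)
open import Data.Maybe.Properties using (just-injective)
import Data.Nat as ℕ
open import Data.Nat using (zero; _∸_; _<_; _≤_; s≤s; z≤n; z<s)
open import Data.Nat.ListAction using (sum)
open import Data.Nat.ListAction.Properties using (sum-++)
open import Data.Nat.Properties
  using ( +-*-semiring; +-commutativeSemigroup; +-comm; +-suc; +-identityʳ; *-identityˡ; *-zeroʳ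
        ; _≟_; _≤?_; m<n⇒m<1+n; <-trans; n<1+n; m<m+n; <⇒≱; <⇒≤; <⇒≢; ≤-reflexive; ≤∧≢⇒<; m≤n+m
        ; m∸n+n≡m; +-cancelʳ-<; +-cancelʳ-≡; suc-injective )
open import Algebra.Properties.CommutativeSemigroup +-commutativeSemigroup using (x∙yz≈y∙xz)
open import Algebra.Properties.Semiring.Sum +-*-semiring
  using (sum-syntax; sum-cong-≗; sum-replicate-zero; *-distribʳ-sum)
import Data.Nat.Tactic.RingSolver as ℕ-Solver
open import Data.Product using (Σ; _,_; proj₁; proj₂)
open import Data.Sum using (_⊎_; inj₁; inj₂)
open import Data.Sum.Properties using (≡-dec; inj₁-injective)
open import Data.Vec using (Vec; []; _∷_; lookup; toList)
open import Function using (_∘_; id)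
open import Level using (0ℓ)
open import Relation.Nullary using (¬_; Dec; yes; no)
open import Relation.Unary using (Pred; Decidable; _⊆_; _≐_)
open import Relation.Binary.PropositionalEquality
  using (_≢_; refl; sym; trans; cong; cong₂; subst; subst₂; module ≡-Reasoning)
open ≡-Reasoning

-- Let invCount n d be the number of signed involutions of n points with
-- signature d = #(+) − #(−).  Splitting by what happens to the first point
-- (fixed with sign +, fixed with sign −, or exchanged with one of the n − 1
-- others) gives
--     invCount n d = invCount (n−1) (d−1) + invCount (n−1) (d+1) + (n−1) invCount (n−2) d.
-- We define invCount by this recursion and show α p q = invCount (p+q) (p−q);
-- the corollary is then the recursion at n = p+q+2, d = p−q, together with
-- invCount n n = invCount n (−n) = 1 (a single sign pattern, no pairs).
--
-- We read a code from left to right.  After reading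
-- positions < r, the state is a demand φ: each later position g is either
-- still open, or demanded to point back to an earlier position that chose it.
-- The module Scan shows (theorem counted) that the consistent completions
-- are counted by invCount of the number of open positions; splitting the
-- enumeration by its first letter reproduces exactly the three terms above.

count : ∀ {A : Set} {P : Pred A 0ℓ} → Decidable P → List A → ℕ
count P? xs = length (filter P? xs)

module _ {A : Set} {P : Pred A 0ℓ} (P? : Decidable P) where

  count-++ : ∀ xs ys → count P? (xs ++ ys) ≡ count P? xs + count P? ys
  count-++ xs ys = trans (cong length (filter-++ P? xs ys)) (length-++ (filter P? xs))

  count-concatMap : ∀ {B : Set} (f : B → List A) xs →
                    count P? (concatMap f xs) ≡ sum (map (count P? ∘ f) xs)
  count-concatMap f []       = refl
  count-concatMap f (x ∷ xs) =
    trans (count-++ (f x) (concatMap f xs)) (cong (λ n → count P? (f x) + n) (count-concatMap f xs))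

  count-map : ∀ {B : Set} (f : B → A) xs → count P? (map f xs) ≡ count (P? ∘ f) xs
  count-map f []       = refl
  count-map f (x ∷ xs) with P? (f x)
  ... | yes _ = cong suc (count-map f xs)
  ... | no  _ = count-map f xs

  count-none : (∀ x → ¬ P x) → ∀ xs → count P? xs ≡ 0
  count-none ¬P xs = cong length (filter-none P? (universal ¬P xs))

count-allVecs-suc : ∀ {A : Set} {m} {P : Pred (Vec A (suc m)) 0ℓ} (P? : Decidable P) (xs : List A) →
                    count P? (allVecs xs (suc m)) ≡ sum (map (λ x → count (P? ∘ (x ∷_)) (allVecs xs m)) xs)
count-allVecs-suc {m = m} P? xs =
  trans (count-concatMap P? (λ x → map (x ∷_) (allVecs xs m)) xs)
        (cong sum (map-cong (λ x → count-map P? (x ∷_) (allVecs xs m)) xs))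

count-suc : ∀ {n} {R : Pred (Fin (suc n)) 0ℓ} (R? : Decidable R) →
            count R? (tabulate suc) ≡ count (R? ∘ suc) (allFin n)
count-suc {n} R? = trans (cong (count R?) (sym (map-tabulate id suc))) (count-map R? suc (allFin n))

count-lookup : ∀ {A : Set} {Q : Pred A 0ℓ} (Q? : Decidable Q) {n} (v : Vec A n) →
               count (Q? ∘ lookup v) (allFin n) ≡ count Q? (toList v)
count-lookup Q? []      = refl
count-lookup Q? (x ∷ v) with Q? x
... | yes _ = cong suc (trans (count-suc (Q? ∘ lookup (x ∷ v))) (count-lookup Q? v))
... | no  _ = trans (count-suc (Q? ∘ lookup (x ∷ v))) (count-lookup Q? v)

sum-allFin : ∀ {n} (f : Fin n → ℕ) → sum (map f (allFin n)) ≡ ∑[ j < n ] f j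
sum-allFin f = trans (cong sum (map-tabulate id f)) (sum-tabulate f)
  where
  sum-tabulate : ∀ {n} (f : Fin n → ℕ) → sum (tabulate f) ≡ ∑[ j < n ] f j
  sum-tabulate {zero}  f = refl
  sum-tabulate {suc n} f = cong (λ s → f zero + s) (sum-tabulate (f ∘ suc))

∑-split : ∀ {n} (a : Fin n) (f g : Fin n → ℕ) → g a ≡ 0 → (∀ j → j ≢ a → f j ≡ g j) →
          ∑[ j < n ] f j ≡ f a + ∑[ j < n ] g j
∑-split {suc n} zero    f g ga≡0 agree =
  cong₂ (λ x s → f zero + (x + s)) (sym ga≡0) (sum-cong-≗ (λ j → agree (suc j) λ ()))
∑-split {suc n} (suc a) f g ga≡0 agree = begin
  f zero + ∑[ j < n ] f (suc j)                ≡⟨ cong₂ _+_ (agree zero λ ()) split-tail ⟩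
  g zero + (f (suc a) + ∑[ j < n ] g (suc j))  ≡⟨ x∙yz≈y∙xz (g zero) (f (suc a)) _ ⟩
  f (suc a) + (g zero + ∑[ j < n ] g (suc j))  ∎
  where
  split-tail : ∑[ j < n ] f (suc j) ≡ f (suc a) + ∑[ j < n ] g (suc j)
  split-tail = ∑-split a (f ∘ suc) (g ∘ suc) ga≡0 λ j j≢a → agree (suc j) (j≢a ∘ Fin-suc-injective)

∑-one : ∀ n → ∑[ j < n ] 1 ≡ n
∑-one zero    = refl
∑-one (suc n) = cong suc (∑-one n)

-- invCount n d : the number of signed involutions of n points with
-- signature d, defined by the first-point recursion (for one point there is
-- nobody to exchange with, hence the 0).
invCount : ℕ → ℤ → ℕ
invCount zero          (+ zero) = 1
invCount zero          _        = 0
invCount (suc zero)    d        = invCount 0 (ℤ.pred d) + invCount 0 (ℤ.suc d) + 0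
invCount (suc (suc n)) d        = invCount (suc n) (ℤ.pred d) + invCount (suc n) (ℤ.suc d) + suc n * invCount n d

invCount-suc : ∀ n d → invCount (suc n) d ≡
                       invCount n (ℤ.pred d) + invCount n (ℤ.suc d) + n * invCount (ℕ.pred n) d
invCount-suc zero    d = refl
invCount-suc (suc n) d = refl

invCount-zero : ∀ {d} → d ≢ 0ℤ → invCount 0 d ≡ 0
invCount-zero {+ zero}    d≢0 = ⊥-elim (d≢0 refl)
invCount-zero {+ suc _}   _   = refl
invCount-zero { -[1+ _ ]} _   = refl

invCount-vanish : ∀ n e → n < e → invCount n (+ e) ≡ 0
invCount-vanish zero          (suc e)       _           = refl
invCount-vanish (suc zero)    (suc zero)    (s≤s ())
invCount-vanish (suc zero)    (suc (suc e)) _           = refl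
invCount-vanish (suc (suc n)) (suc e)       (s≤s 1+n<e) = begin
  invCount (suc n) (+ e) + invCount (suc n) (+ suc (suc e)) + suc n * invCount n (+ suc e)
    ≡⟨ cong₂ _+_ (cong₂ _+_ (invCount-vanish (suc n) e 1+n<e)
                            (invCount-vanish (suc n) (suc (suc e)) (m<n⇒m<1+n (m<n⇒m<1+n 1+n<e))))
                 (cong (suc n *_) (invCount-vanish n (suc e) (m<n⇒m<1+n (<-trans (n<1+n n) 1+n<e)))) ⟩
  suc n * 0 ≡⟨ *-zeroʳ (suc n) ⟩
  0         ∎

invCount-top : ∀ n → invCount n (+ n) ≡ 1
invCount-top zero          = refl
invCount-top (suc zero)    = refl
invCount-top (suc (suc n)) = begin
  invCount (suc n) (+ suc n) + invCount (suc n) (+ suc (suc (suc n))) + suc n * invCount n (+ suc (suc n))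
    ≡⟨ cong₂ _+_ (cong₂ _+_ (invCount-top (suc n))
                            (invCount-vanish (suc n) (suc (suc (suc n))) (m<n⇒m<1+n (n<1+n (suc n)))))
                 (cong (suc n *_) (invCount-vanish n (suc (suc n)) (m<n⇒m<1+n (n<1+n n)))) ⟩
  1 + 0 + suc n * 0 ≡⟨ cong (λ x → 1 + x) (*-zeroʳ (suc n)) ⟩
  1                 ∎

-- Exchanging all signs negates the signature: the inductive step, given the
-- symmetry for n and n − 1 points.
invCount-neg-step : ∀ n → (∀ d → invCount n (- d) ≡ invCount n d) →
                    (∀ d → invCount (ℕ.pred n) (- d) ≡ invCount (ℕ.pred n) d) →
                    ∀ d → invCount (suc n) (- d) ≡ invCount (suc n) d
invCount-neg-step n sym-n sym-n-1 d = begin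
  invCount (suc n) (- d)                                                   ≡⟨ invCount-suc n (- d) ⟩
  invCount n (ℤ.pred (- d)) + invCount n (ℤ.suc (- d)) + n * invCount (ℕ.pred n) (- d)
    ≡⟨ cong₂ _+_ (cong₂ _+_ (trans (cong (invCount n) (pred-neg d)) (sym-n (ℤ.suc d)))
                            (trans (cong (invCount n) (suc-neg d)) (sym-n (ℤ.pred d))))
                 (cong (n *_) (sym-n-1 d)) ⟩
  invCount n (ℤ.suc d) + invCount n (ℤ.pred d) + n * invCount (ℕ.pred n) d
    ≡⟨ cong (_+ n * invCount (ℕ.pred n) d) (+-comm (invCount n (ℤ.suc d)) _) ⟩
  invCount n (ℤ.pred d) + invCount n (ℤ.suc d) + n * invCount (ℕ.pred n) d  ≡⟨ invCount-suc n d ⟨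
  invCount (suc n) d                                                       ∎
  where
  pred-neg : ∀ d → -1ℤ ℤ.+ - d ≡ - (1ℤ ℤ.+ d)
  pred-neg = ℤ-Solver.solve-∀
  suc-neg : ∀ d → 1ℤ ℤ.+ - d ≡ - (-1ℤ ℤ.+ d)
  suc-neg = ℤ-Solver.solve-∀

invCount-neg : ∀ n d → invCount n (- d) ≡ invCount n d
invCount-neg zero          (+ zero)  = refl
invCount-neg zero          (+ suc _) = refl
invCount-neg zero          -[1+ _ ]  = refl
invCount-neg (suc zero)    = invCount-neg-step zero (invCount-neg zero) (invCount-neg zero)
invCount-neg (suc (suc n)) = invCount-neg-step (suc n) (invCount-neg (suc n)) (invCount-neg n)

invCount-bottom : ∀ n → invCount n (- + n) ≡ 1
invCount-bottom n = trans (invCount-neg n (+ n)) (invCount-top n)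

at : ∀ {A : Set} {m} → Vec A m → ℕ → Maybe A
at []      k       = nothing
at (x ∷ w) zero    = just x
at (x ∷ w) (suc k) = at w k

at-total : ∀ {A : Set} {m} (w : Vec A m) k → k < m → Σ A λ x → at w k ≡ just x
at-total (x ∷ w) zero    _         = x , refl
at-total (x ∷ w) (suc k) (s≤s k<m) = at-total w k k<m

at-lookup : ∀ {A : Set} {n} (v : Vec A n) i → at v (toℕ i) ≡ just (lookup v i)
at-lookup (x ∷ v) zero    = refl
at-lookup (x ∷ v) (suc i) = at-lookup v i

at-index : ∀ {A : Set} {n} (v : Vec A n) k {x} → at v k ≡ just x →
           Σ (Fin n) λ i → toℕ i ≡ k × lookup v i ≡ x
at-index (y ∷ v) zero    e = zero , refl , just-injective e
at-index (y ∷ v) (suc k) e with at-index v k e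
... | i , i≡k , v[i]≡x = suc i , cong suc i≡k , v[i]≡x

just≢nothing : ∀ {A : Set} {a : A} → just a ≢ nothing
just≢nothing ()

-- Positions are written  k + r  (k-th entry of a word read from r on).
r<k+suc-r : ∀ k r → r < k + suc r
r<k+suc-r k r = subst (r <_) (sym (+-suc k r)) (s≤s (m≤n+m r k))

+suc-cancel : ∀ k′ k r → k′ + suc r ≡ suc (k + r) → k′ ≡ k
+suc-cancel k′ k r e = +-cancelʳ-≡ r k′ k (suc-injective (trans (sym (+-suc k′ r)) e))

shift unshift : Sign → ℤ → ℤ
shift   plus  = ℤ.suc
shift   minus = ℤ.pred
unshift plus  = ℤ.pred
unshift minus = ℤ.suc

shift-unshift : ∀ s d → shift s (unshift s d) ≡ d
shift-unshift plus  = suc-pred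
shift-unshift minus = pred-suc

unshift-shift : ∀ s d → unshift s (shift s d) ≡ d
unshift-shift plus  = pred-suc
unshift-shift minus = suc-pred

one-more-plus : ∀ a b → (1ℤ ℤ.+ a) - b ≡ 1ℤ ℤ.+ (a - b)
one-more-plus = ℤ-Solver.solve-∀

one-more-minus : ∀ a b → a - (1ℤ ℤ.+ b) ≡ -1ℤ ℤ.+ (a - b)
one-more-minus = ℤ-Solver.solve-∀

module Scan (N : ℕ) where

  Entry : Set
  Entry = Fin N ⊎ Sign

  signature : ∀ {m} → Vec Entry m → ℤ
  signature []           = 0ℤ
  signature (inj₁ _ ∷ w) = signature w
  signature (inj₂ s ∷ w) = shift s (signature w)

  -- A demand records, for each position g not yet read, whether an earlier
  -- position a has chosen g as its partner (just a) or g is open (nothing).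
  Demand : Set
  Demand = ℕ → Maybe (Fin N)

  record Partner {m} (r : ℕ) (φ : Demand) (w : Vec Entry m) (g : ℕ) (x : Entry) : Set where
    constructor partner
    field
      j       : Fin N
      k       : ℕ
      x≡j     : x ≡ inj₁ j
      j≡k+r   : toℕ j ≡ k + r
      j≢g     : toℕ j ≢ g
      j-open  : φ (k + r) ≡ nothing
      j′      : Fin N
      w[k]≡j′ : at w k ≡ just (inj₁ j′)
      j′≡g    : toℕ j′ ≡ g

  data Fits {m} (r : ℕ) (φ : Demand) (w : Vec Entry m) (g : ℕ) (x : Entry) : Set where
    demanded : ∀ a → φ g ≡ just a → x ≡ inj₁ a → Fits r φ w g x
    signed   : ∀ s → φ g ≡ nothing → x ≡ inj₂ s → Fits r φ w g x
    paired   : φ g ≡ nothing → Partner r φ w g x → Fits r φ w g x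

  Consistent : ∀ {m} → ℕ → Demand → Vec Entry m → Set
  Consistent r φ w = ∀ k x → at w k ≡ just x → Fits r φ w (k + r) x

  Spec : ∀ {m} → ℕ → Demand → ℤ → Vec Entry m → Set
  Spec r φ d w = Consistent r φ w × signature w ≡ d

  fits-at : ∀ {m r φ} {w : Vec Entry m} {g g′ x} → g ≡ g′ → Fits r φ w g x → Fits r φ w g′ x
  fits-at refl f = f

  -- Moving the reading position across a head y.  Dropping y is possible
  -- when y is not an open position pointing into the rest of the word.
  module _ {m r : ℕ} {φ : Demand} {w : Vec Entry m} {y : Entry} where

    NotPairing : Set
    NotPairing = ∀ j → φ r ≡ nothing → y ≡ inj₁ j → ⊥

    partner-push : ∀ {g x} → Partner (suc r) φ w g x → Partner r φ (y ∷ w) g x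
    partner-push (partner j k x≡j j≡ j≢g j-open j′ w[k] j′≡g) =
      partner j (suc k) x≡j (trans j≡ (+-suc k r)) j≢g
              (subst (λ p → φ p ≡ nothing) (+-suc k r) j-open) j′ w[k] j′≡g

    partner-pop : ∀ {g x} → NotPairing → Partner r φ (y ∷ w) g x → Partner (suc r) φ w g x
    partner-pop np (partner j zero    _   _  _   j-open j′ w[k] _) = ⊥-elim (np j′ j-open (just-injective w[k]))
    partner-pop np (partner j (suc k) x≡j j≡ j≢g j-open j′ w[k] j′≡g) =
      partner j k x≡j (trans j≡ (sym (+-suc k r))) j≢g
              (subst (λ p → φ p ≡ nothing) (sym (+-suc k r)) j-open) j′ w[k] j′≡g

    fits-push : ∀ {g x} → Fits (suc r) φ w g x → Fits r φ (y ∷ w) g x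
    fits-push (demanded a e x≡a) = demanded a e x≡a
    fits-push (signed s e x≡s)   = signed s e x≡s
    fits-push (paired e p)       = paired e (partner-push p)

    fits-pop : ∀ {g x} → NotPairing → Fits r φ (y ∷ w) g x → Fits (suc r) φ w g x
    fits-pop np (demanded a e x≡a) = demanded a e x≡a
    fits-pop np (signed s e x≡s)   = signed s e x≡s
    fits-pop np (paired e p)       = paired e (partner-pop np p)

    consistent-tail : NotPairing → Consistent r φ (y ∷ w) → Consistent (suc r) φ w
    consistent-tail np c k x e = fits-at (sym (+-suc k r)) (fits-pop np (c (suc k) x e))

    consistent-cons : Fits r φ (y ∷ w) r y →
                      (∀ k x → at w k ≡ just x → Fits r φ (y ∷ w) (k + suc r) x) →
                      Consistent r φ (y ∷ w)
    consistent-cons f c zero    x refl = f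
    consistent-cons f c (suc k) x e    = fits-at (+-suc k r) (c k x e)

    consistent-push : Fits r φ (y ∷ w) r y → Consistent (suc r) φ w → Consistent r φ (y ∷ w)
    consistent-push f c = consistent-cons f (λ k x e → fits-push (c k x e))

  module _ {m r : ℕ} {φ : Demand} {w : Vec Entry m} {d : ℤ} {a : Fin N} (φr≡a : φ r ≡ just a) where

    demanded-uncons : ∀ {y} → Spec r φ d (y ∷ w) → y ≡ inj₁ a × Spec (suc r) φ d w
    demanded-uncons {y} (c , sig≡d) with c 0 y refl
    ... | demanded a′ φr≡a′ y≡a′ =
          y≡a , consistent-tail (λ _ φr≡∅ _ → just≢nothing (trans (sym φr≡a) φr≡∅)) c
              , subst (λ z → signature (z ∷ w) ≡ d) y≡a sig≡d
      where
      y≡a : y ≡ inj₁ a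
      y≡a = trans y≡a′ (cong inj₁ (just-injective (trans (sym φr≡a′) φr≡a)))
    ... | signed _ φr≡∅ _ = ⊥-elim (just≢nothing (trans (sym φr≡a) φr≡∅))
    ... | paired φr≡∅ _   = ⊥-elim (just≢nothing (trans (sym φr≡a) φr≡∅))

    demanded-cons : Spec (suc r) φ d w → Spec r φ d (inj₁ a ∷ w)
    demanded-cons (c , sig≡d) = consistent-push (demanded a φr≡a refl) c , sig≡d

  module _ {m r : ℕ} {φ : Demand} {w : Vec Entry m} {d : ℤ} (φr≡∅ : φ r ≡ nothing) (s : Sign) where

    signed-uncons : Spec r φ d (inj₂ s ∷ w) → Spec (suc r) φ (unshift s d) w
    signed-uncons (c , sig≡d) =
      consistent-tail (λ _ _ ()) c , trans (sym (unshift-shift s _)) (cong (unshift s) sig≡d)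

    signed-cons : Spec (suc r) φ (unshift s d) w → Spec r φ d (inj₂ s ∷ w)
    signed-cons (c , sig≡d) =
      consistent-push (signed s φr≡∅ refl) c , trans (cong (shift s) sig≡d) (shift-unshift s d)

  _[_≔_] : Demand → ℕ → Fin N → Demand
  (φ [ t ≔ ρ ]) g with g ≟ t
  ... | yes _ = just ρ
  ... | no  _ = φ g

  update-here : ∀ φ t ρ {g} → g ≡ t → (φ [ t ≔ ρ ]) g ≡ just ρ
  update-here φ t ρ {g} g≡t with g ≟ t
  ... | yes _   = refl
  ... | no  g≢t = ⊥-elim (g≢t g≡t)

  update-there : ∀ φ t ρ {g} → g ≢ t → (φ [ t ≔ ρ ]) g ≡ φ g
  update-there φ t ρ {g} g≢t with g ≟ t
  ... | yes g≡t = ⊥-elim (g≢t g≡t)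
  ... | no  _   = refl

  update-open : ∀ φ t ρ {g} → (φ [ t ≔ ρ ]) g ≡ nothing → φ g ≡ nothing
  update-open φ t ρ {g} e with g ≟ t
  ... | yes _ = ⊥-elim (just≢nothing e)
  ... | no  _ = e

  Available : ℕ → Demand → Fin N → Set
  Available r φ j = r < toℕ j × φ (toℕ j) ≡ nothing

  module _ {m r : ℕ} {φ : Demand} {w : Vec Entry m} {d : ℤ} {j : Fin N}
           {ρ : Fin N} (ρ≡r : toℕ ρ ≡ r) (φr≡∅ : φ r ≡ nothing) where

    private
      φ′ : Demand
      φ′ = φ [ toℕ j ≔ ρ ]

    record HeadPartner : Set where
      constructor headPartner
      field
        k      : ℕ
        j≡     : toℕ j ≡ suc (k + r)
        j-open : φ (toℕ j) ≡ nothing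
        w[k]≡ρ : at w k ≡ just (inj₁ ρ)

    head-partner : Fits r φ (inj₁ j ∷ w) r (inj₁ j) → HeadPartner
    head-partner (demanded _ φr≡a _) = ⊥-elim (just≢nothing (trans (sym φr≡a) φr≡∅))
    head-partner (signed _ _ ())
    head-partner (paired _ (partner _ zero    _    j≡r j≢r _ _ _ _)) = ⊥-elim (j≢r j≡r)
    head-partner (paired _ (partner _ (suc k) refl j≡ _ j-open j′ w[k] j′≡r)) =
      headPartner k j≡ (subst (λ p → φ p ≡ nothing) (sym j≡) j-open)
                  (trans w[k] (cong (just ∘ inj₁) (toℕ-injective (trans j′≡r (sym ρ≡r)))))

    fits-update-pop : HeadPartner → ∀ {g x} → r < g → g ≢ toℕ j →
                      Fits r φ (inj₁ j ∷ w) g x → Fits (suc r) φ′ w g x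
    fits-update-pop _ _ g≢j (demanded a e x≡a) = demanded a (trans (update-there φ _ ρ g≢j) e) x≡a
    fits-update-pop _ _ g≢j (signed s e x≡s)   = signed s (trans (update-there φ _ ρ g≢j) e) x≡s
    fits-update-pop _ _ g≢j (paired _ (partner _ zero _ _ _ _ _ refl j′≡g)) = ⊥-elim (g≢j (sym j′≡g))
    fits-update-pop (headPartner k j≡ _ w[k]≡ρ) {g} r<g g≢j
                    (paired e (partner i (suc k′) x≡i i≡ i≢g i-open i′ w[k′] i′≡g)) =
      paired (trans (update-there φ _ ρ g≢j) e)
             (partner i k′ x≡i (trans i≡ (sym (+-suc k′ r))) i≢g (still-open (k′ + suc r ≟ toℕ j)) i′ w[k′] i′≡g)
      where
      -- The partner i of g is not the partner of the head, which points to r < g.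
      still-open : Dec (k′ + suc r ≡ toℕ j) → φ′ (k′ + suc r) ≡ nothing
      still-open (no  i≢j) = trans (update-there φ _ ρ i≢j) (subst (λ p → φ p ≡ nothing) (sym (+-suc k′ r)) i-open)
      still-open (yes i≡j) = ⊥-elim (<⇒≢ r<g (trans (sym ρ≡r) (trans (cong toℕ ρ≡i′) i′≡g)))
        where
        ρ≡i′ : ρ ≡ i′
        ρ≡i′ = inj₁-injective (just-injective
                 (trans (sym w[k]≡ρ) (trans (cong (at w) (sym (+suc-cancel k′ k r (trans i≡j j≡)))) w[k′])))

    paired-uncons : Spec r φ d (inj₁ j ∷ w) → Available r φ j × Spec (suc r) φ′ d w
    paired-uncons (c , sig≡d) = (r<j , j-open) , consistent-rest , sig≡d
      where
      hp : HeadPartner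
      hp = head-partner (c 0 (inj₁ j) refl)
      open HeadPartner hp
      r<j : r < toℕ j
      r<j = subst (r <_) (sym j≡) (s≤s (m≤n+m r k))
      fits-rest : ∀ k′ x → at w k′ ≡ just x → Dec (k′ + suc r ≡ toℕ j) → Fits (suc r) φ′ w (k′ + suc r) x
      fits-rest k′ x w[k′]≡x (yes g≡j) = demanded ρ (update-here φ _ ρ g≡j) x≡ρ
        where
        x≡ρ : x ≡ inj₁ ρ
        x≡ρ = just-injective (trans (sym w[k′]≡x) (trans (cong (at w) (+suc-cancel k′ k r (trans g≡j j≡))) w[k]≡ρ))
      fits-rest k′ x w[k′]≡x (no g≢j) =
        fits-update-pop hp (r<k+suc-r k′ r) g≢j (fits-at (sym (+-suc k′ r)) (c (suc k′) x w[k′]≡x))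
      consistent-rest : Consistent (suc r) φ′ w
      consistent-rest k′ x e = fits-rest k′ x e (k′ + suc r ≟ toℕ j)

    -- Conversely, fitting after the update implies fitting before it; the
    -- entry at toℕ j becomes the partner of the head.
    fits-update-push : Available r φ j → ∀ {g x} → r < g →
                       Fits (suc r) φ′ w g x → Dec (g ≡ toℕ j) → Fits r φ (inj₁ j ∷ w) g x
    fits-update-push (_ , j-open) {g} {x} r<g (demanded a e x≡a) (yes g≡j) =
      paired (subst (λ p → φ p ≡ nothing) (sym g≡j) j-open)
             (partner ρ zero x≡ρ ρ≡r (λ ρ≡g → <⇒≢ r<g (trans (sym ρ≡r) ρ≡g)) φr≡∅ j refl (sym g≡j))
      where
      x≡ρ : x ≡ inj₁ ρ
      x≡ρ = trans x≡a (cong inj₁ (just-injective (trans (sym e) (update-here φ _ ρ g≡j))))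
    fits-update-push _ _ (signed _ e _) (yes g≡j) = ⊥-elim (just≢nothing (trans (sym (update-here φ _ ρ g≡j)) e))
    fits-update-push _ _ (paired e _)   (yes g≡j) = ⊥-elim (just≢nothing (trans (sym (update-here φ _ ρ g≡j)) e))
    fits-update-push _ _ (demanded a e x≡a) (no g≢j) = demanded a (trans (sym (update-there φ _ ρ g≢j)) e) x≡a
    fits-update-push _ _ (signed s e x≡s)   (no g≢j) = signed s (trans (sym (update-there φ _ ρ g≢j)) e) x≡s
    fits-update-push _ _ (paired e (partner i k′ x≡i i≡ i≢g i-open i′ w[k′] i′≡g)) (no g≢j) =
      paired (trans (sym (update-there φ _ ρ g≢j)) e)
             (partner i (suc k′) x≡i (trans i≡ (+-suc k′ r)) i≢g
                      (subst (λ p → φ p ≡ nothing) (+-suc k′ r) (update-open φ _ ρ i-open)) i′ w[k′] i′≡g)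

    -- The length bound r + suc m ≡ N guarantees that position toℕ j lies in w.
    paired-cons : r + suc m ≡ N → Available r φ j → Spec (suc r) φ′ d w → Spec r φ d (inj₁ j ∷ w)
    paired-cons r+1+m≡N av@(r<j , j-open) (c′ , sig≡d) =
      consistent-cons head-fits (λ k′ x e → fits-update-push av (r<k+suc-r k′ r) (c′ k′ x e) (k′ + suc r ≟ toℕ j))
      , sig≡d
      where
      k : ℕ
      k = toℕ j ∸ suc r
      k+1+r≡j : k + suc r ≡ toℕ j
      k+1+r≡j = m∸n+n≡m r<j
      N≡m+1+r : N ≡ m + suc r
      N≡m+1+r = trans (sym r+1+m≡N) (trans (+-comm r (suc m)) (sym (+-suc m r)))
      k<m : k < m
      k<m = +-cancelʳ-< (suc r) k m (subst₂ _<_ (sym k+1+r≡j) N≡m+1+r (toℕ<n j))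
      x : Entry
      x = proj₁ (at-total w k k<m)
      w[k]≡x : at w k ≡ just x
      w[k]≡x = proj₂ (at-total w k k<m)
      x≡ρ : Fits (suc r) φ′ w (k + suc r) x → x ≡ inj₁ ρ
      x≡ρ (demanded a e x≡a) = trans x≡a (cong inj₁ (just-injective (trans (sym e) (update-here φ _ ρ k+1+r≡j))))
      x≡ρ (signed _ e _)     = ⊥-elim (just≢nothing (trans (sym (update-here φ _ ρ k+1+r≡j)) e))
      x≡ρ (paired e _)       = ⊥-elim (just≢nothing (trans (sym (update-here φ _ ρ k+1+r≡j)) e))
      j≡ : toℕ j ≡ suc k + r
      j≡ = trans (sym k+1+r≡j) (+-suc k r)
      head-fits : Fits r φ (inj₁ j ∷ w) r (inj₁ j)
      head-fits = paired φr≡∅ (partner j (suc k) refl j≡ (λ j≡r → <⇒≢ r<j (sym j≡r))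
                                       (subst (λ p → φ p ≡ nothing) j≡ j-open)
                                       ρ (trans w[k]≡x (cong just (x≡ρ (c′ k x w[k]≡x)))) ρ≡r)

  vacancy : Maybe (Fin N) → ℕ
  vacancy nothing  = 1
  vacancy (just _) = 0

  openAt : ℕ → Demand → Fin N → ℕ
  openAt r φ j with r ≤? toℕ j
  ... | yes _ = vacancy (φ (toℕ j))
  ... | no  _ = 0

  openCount : ℕ → Demand → ℕ
  openCount r φ = ∑[ j < N ] openAt r φ j

  openAt-yes : ∀ {r φ j} → r ≤ toℕ j → openAt r φ j ≡ vacancy (φ (toℕ j))
  openAt-yes {r} {φ} {j} r≤j with r ≤? toℕ j
  ... | yes _   = refl
  ... | no  r≰j = ⊥-elim (r≰j r≤j)

  openAt-no : ∀ {r φ j} → ¬ r ≤ toℕ j → openAt r φ j ≡ 0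
  openAt-no {r} {φ} {j} r≰j with r ≤? toℕ j
  ... | yes r≤j = ⊥-elim (r≰j r≤j)
  ... | no  _   = refl

  openCount-start : openCount 0 (λ _ → nothing) ≡ N
  openCount-start =
    trans (sum-cong-≗ {N} {openAt 0 (λ _ → nothing)} {λ _ → 1} λ j → openAt-yes {φ = λ _ → nothing} {j} z≤n)
          (∑-one N)

  openCount-end : ∀ φ → openCount N φ ≡ 0
  openCount-end φ = trans (sum-cong-≗ λ j → openAt-no (<⇒≱ (toℕ<n j))) (sum-replicate-zero N)

  openCount-step : ∀ {r} φ (ρ : Fin N) → toℕ ρ ≡ r → openCount r φ ≡ vacancy (φ r) + openCount (suc r) φ
  openCount-step {r} φ ρ ρ≡r =
    trans (∑-split ρ (openAt r φ) (openAt (suc r) φ) (openAt-no λ 1+r≤ρ → <⇒≢ 1+r≤ρ (sym ρ≡r))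
                   (λ j j≢ρ → same-elsewhere j j≢ρ (r ≤? toℕ j)))
          (cong (_+ openCount (suc r) φ) (trans (openAt-yes (≤-reflexive (sym ρ≡r))) (cong (vacancy ∘ φ) ρ≡r)))
    where
    same-elsewhere : ∀ j → j ≢ ρ → Dec (r ≤ toℕ j) → openAt r φ j ≡ openAt (suc r) φ j
    same-elsewhere j j≢ρ (no r≰j)  = trans (openAt-no r≰j) (sym (openAt-no (r≰j ∘ <⇒≤)))
    same-elsewhere j j≢ρ (yes r≤j) = trans (openAt-yes r≤j) (sym (openAt-yes (≤∧≢⇒< r≤j r≢j)))
      where
      r≢j : r ≢ toℕ j
      r≢j r≡j = j≢ρ (toℕ-injective (trans (sym r≡j) (sym ρ≡r)))

  openCount-update : ∀ {r} φ (ρ j : Fin N) → Available r φ j →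
                     openCount (suc r) φ ≡ suc (openCount (suc r) (φ [ toℕ j ≔ ρ ]))
  openCount-update {r} φ ρ j (r<j , j-open) =
    trans (∑-split j (openAt (suc r) φ) (openAt (suc r) φ′)
                   (trans (openAt-yes r<j) (cong vacancy (update-here φ (toℕ j) ρ refl)))
                   (λ i i≢j → same-elsewhere i i≢j (suc r ≤? toℕ i)))
          (cong (_+ openCount (suc r) φ′) (trans (openAt-yes r<j) (cong vacancy j-open)))
    where
    φ′ : Demand
    φ′ = φ [ toℕ j ≔ ρ ]
    same-elsewhere : ∀ i → i ≢ j → Dec (suc r ≤ toℕ i) → openAt (suc r) φ i ≡ openAt (suc r) φ′ i
    same-elsewhere i i≢j (no r≮i)  = trans (openAt-no r≮i) (sym (openAt-no r≮i))
    same-elsewhere i i≢j (yes r<i) =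
      trans (openAt-yes r<i) (sym (trans (openAt-yes r<i) (cong vacancy (update-there φ _ ρ (i≢j ∘ toℕ-injective)))))

  entries : List Entry
  entries = allSignedEntries N

  sum-entries : (c : Entry → ℕ) →
                sum (map c entries) ≡ ∑[ j < N ] c (inj₁ j) + (c (inj₂ plus) + (c (inj₂ minus) + 0))
  sum-entries c = begin
    sum (map c (pointers ++ signs))                ≡⟨ cong sum (map-++ c pointers signs) ⟩
    sum (map c pointers ++ map c signs)            ≡⟨ sum-++ (map c pointers) (map c signs) ⟩
    sum (map c pointers) + sum (map c signs)       ≡⟨ cong (_+ sum (map c signs)) pointer-sum ⟩
    ∑[ j < N ] c (inj₁ j) + sum (map c signs)      ∎
    where
    pointers signs : List Entry
    pointers = map inj₁ (allFin N)
    signs    = inj₂ plus ∷ inj₂ minus ∷ []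
    pointer-sum : sum (map c pointers) ≡ ∑[ j < N ] c (inj₁ j)
    pointer-sum = trans (cong sum (sym (map-∘ (allFin N)))) (sum-allFin (c ∘ inj₁))

  Counted : ℕ → Set₁
  Counted m = ∀ r φ d {P : Pred (Vec Entry m) 0ℓ} (P? : Decidable P) → P ≐ Spec r φ d → r + m ≡ N →
              count P? (allVecs entries m) ≡ invCount (openCount r φ) d

  -- The empty word is consistent, so it is counted exactly when d = 0.
  counted-zero : Counted 0
  counted-zero r φ d {P} P? (P⊆S , S⊆P) r+0≡N =
    trans empty-word (cong (λ n → invCount n d) (sym nothing-open))
    where
    empty-word : count P? (allVecs entries 0) ≡ invCount 0 d
    empty-word with P? []
    ... | yes p  = cong (invCount 0) (proj₂ (P⊆S p))
    ... | no  ¬p = sym (invCount-zero λ d≡0 → ¬p (S⊆P ((λ _ _ ()) , sym d≡0)))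
    nothing-open : openCount r φ ≡ 0
    nothing-open = trans (cong (λ p → openCount p φ) (trans (sym (+-identityʳ r)) r+0≡N)) (openCount-end φ)

  module HeadCases {m} (ih : Counted m) {r φ d} {P : Pred (Vec Entry (suc m)) 0ℓ} (P? : Decidable P)
                   (P≐S : P ≐ Spec r φ d) (r+1+m≡N : r + suc m ≡ N) where

    P⊆S : P ⊆ Spec r φ d
    P⊆S = proj₁ P≐S

    S⊆P : Spec r φ d ⊆ P
    S⊆P = proj₂ P≐S

    headed : Entry → ℕ
    headed x = count (P? ∘ (x ∷_)) (allVecs entries m)

    total : ℕ
    total = ∑[ j < N ] headed (inj₁ j) + (headed (inj₂ plus) + (headed (inj₂ minus) + 0))

    1+r+m≡N : suc r + m ≡ N
    1+r+m≡N = trans (sym (+-suc r m)) r+1+m≡N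

    r<N : r < N
    r<N = subst (r <_) r+1+m≡N (m<m+n r z<s)

    ρ : Fin N
    ρ = fromℕ< r<N

    ρ≡r : toℕ ρ ≡ r
    ρ≡r = toℕ-fromℕ< r<N

    F : ℕ
    F = openCount (suc r) φ

    -- A demanded head contributes one term: the words headed by the demand.
    count-demanded : ∀ {a} → φ r ≡ just a → total ≡ invCount (openCount r φ) d
    count-demanded {a} φr≡a = begin
      total                               ≡⟨ cong₂ _+_ pointers (cong₂ _+_ (no-sign plus) (cong (_+ 0) (no-sign minus))) ⟩
      headed (inj₁ a) + 0 + 0             ≡⟨ trans (+-identityʳ _) (+-identityʳ _) ⟩
      headed (inj₁ a)                     ≡⟨ ih (suc r) φ d (P? ∘ (inj₁ a ∷_)) rest-spec 1+r+m≡N ⟩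
      invCount (vacancy (just a) + F) d   ≡⟨ cong (λ v → invCount (vacancy v + F) d) φr≡a ⟨
      invCount (vacancy (φ r) + F) d      ≡⟨ cong (λ n → invCount n d) (openCount-step φ ρ ρ≡r) ⟨
      invCount (openCount r φ) d          ∎
      where
      rest-spec : (P ∘ (inj₁ a ∷_)) ≐ Spec (suc r) φ d
      rest-spec = proj₂ ∘ demanded-uncons φr≡a ∘ P⊆S , S⊆P ∘ demanded-cons φr≡a
      not-a : ∀ {x} → x ≢ inj₁ a → headed x ≡ 0
      not-a {x} x≢a = count-none (P? ∘ (x ∷_)) (λ w p → x≢a (proj₁ (demanded-uncons φr≡a (P⊆S p))))
                                 (allVecs entries m)
      no-sign : ∀ s → headed (inj₂ s) ≡ 0
      no-sign s = not-a λ ()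
      pointers : ∑[ j < N ] headed (inj₁ j) ≡ headed (inj₁ a) + 0
      pointers = trans (∑-split a (headed ∘ inj₁) (λ _ → 0) refl (λ j j≢a → not-a (j≢a ∘ inj₁-injective)))
                       (cong (λ s → headed (inj₁ a) + s) (sum-replicate-zero N))

    module _ (φr≡∅ : φ r ≡ nothing) where

      count-signed : ∀ s → headed (inj₂ s) ≡ invCount F (unshift s d)
      count-signed s = ih (suc r) φ (unshift s d) (P? ∘ (inj₂ s ∷_))
                          (signed-uncons φr≡∅ s ∘ P⊆S , S⊆P ∘ signed-cons φr≡∅ s) 1+r+m≡N

      -- A head pointing to j: no words unless j is available, and then as
      -- many as with one open position less.
      count-paired : ∀ j → headed (inj₁ j) ≡ openAt (suc r) φ j * invCount (ℕ.pred F) d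
      count-paired j = by-cases (suc r ≤? toℕ j) (φ (toℕ j)) refl
        where
        unavailable : ¬ Available r φ j → headed (inj₁ j) ≡ 0
        unavailable ¬av = count-none (P? ∘ (inj₁ j ∷_)) (λ w p → ¬av (proj₁ (paired-uncons ρ≡r φr≡∅ (P⊆S p))))
                                     (allVecs entries m)
        by-cases : Dec (r < toℕ j) → ∀ v → φ (toℕ j) ≡ v →
                   headed (inj₁ j) ≡ openAt (suc r) φ j * invCount (ℕ.pred F) d
        by-cases (no r≮j) _ _ = trans (unavailable (r≮j ∘ proj₁)) (cong (_* _) (sym (openAt-no r≮j)))
        by-cases (yes r<j) (just b) φj≡b =
          trans (unavailable (λ av → just≢nothing (trans (sym φj≡b) (proj₂ av))))
                (cong (_* _) (sym (trans (openAt-yes r<j) (cong vacancy φj≡b))))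
        by-cases (yes r<j) nothing φj≡∅ = begin
          headed (inj₁ j)                             ≡⟨ ih (suc r) φ′ d (P? ∘ (inj₁ j ∷_)) rest-spec 1+r+m≡N ⟩
          invCount (openCount (suc r) φ′) d           ≡⟨ cong (λ n → invCount (ℕ.pred n) d) (openCount-update φ ρ j av) ⟨
          invCount (ℕ.pred F) d                       ≡⟨ *-identityˡ _ ⟨
          1 * invCount (ℕ.pred F) d                   ≡⟨ cong (_* _) (trans (openAt-yes r<j) (cong vacancy φj≡∅)) ⟨
          openAt (suc r) φ j * invCount (ℕ.pred F) d  ∎
          where
          av : Available r φ j
          av = r<j , φj≡∅
          φ′ : Demand
          φ′ = φ [ toℕ j ≔ ρ ]
          rest-spec : (P ∘ (inj₁ j ∷_)) ≐ Spec (suc r) φ′ d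
          rest-spec = proj₂ ∘ paired-uncons ρ≡r φr≡∅ ∘ P⊆S , S⊆P ∘ paired-cons ρ≡r φr≡∅ r+1+m≡N av

      -- An open head contributes the three terms of the recursion.
      count-open : total ≡ invCount (openCount r φ) d
      count-open = begin
        total                           ≡⟨ cong₂ _+_ pointers signs ⟩
        F * X + (A + (B + 0))           ≡⟨ rearrange (F * X) A B ⟩
        A + B + F * X                   ≡⟨ invCount-suc F d ⟨
        invCount (suc F) d              ≡⟨ cong (λ v → invCount (vacancy v + F) d) φr≡∅ ⟨
        invCount (vacancy (φ r) + F) d  ≡⟨ cong (λ n → invCount n d) (openCount-step φ ρ ρ≡r) ⟨
        invCount (openCount r φ) d      ∎
        where
        A B X : ℕ
        A = invCount F (ℤ.pred d)
        B = invCount F (ℤ.suc d)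
        X = invCount (ℕ.pred F) d
        pointers : ∑[ j < N ] headed (inj₁ j) ≡ F * X
        pointers = trans (sum-cong-≗ count-paired) (sym (*-distribʳ-sum X (openAt (suc r) φ)))
        signs : headed (inj₂ plus) + (headed (inj₂ minus) + 0) ≡ A + (B + 0)
        signs = cong₂ _+_ (count-signed plus) (cong (_+ 0) (count-signed minus))
        rearrange : ∀ x a b → x + (a + (b + 0)) ≡ a + b + x
        rearrange = ℕ-Solver.solve-∀

  counted-suc : ∀ {m} → Counted m → Counted (suc m)
  counted-suc {m} ih r φ d P? P≐S r+1+m≡N = begin
    count P? (allVecs entries (suc m)) ≡⟨ count-allVecs-suc P? entries ⟩
    sum (map headed entries)           ≡⟨ sum-entries headed ⟩
    total                              ≡⟨ by-head (φ r) refl ⟩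
    invCount (openCount r φ) d         ∎
    where
    open HeadCases ih P? P≐S r+1+m≡N
    by-head : ∀ v → φ r ≡ v → total ≡ invCount (openCount r φ) d
    by-head (just _) φr≡a = count-demanded φr≡a
    by-head nothing  φr≡∅ = count-open φr≡∅

  counted : ∀ m → Counted m
  counted zero    = counted-zero
  counted (suc m) = counted-suc (counted m)

module Bridge (N : ℕ) where

  open Scan N

  signs : ∀ {m} → Sign → Vec Entry m → ℕ
  signs s w = count (λ y → ≡-dec _≟ᶠ_ _≟ˢ_ y (inj₂ s)) (toList w)

  signs-signature : ∀ {m} (w : Vec Entry m) → + signs plus w - + signs minus w ≡ signature w
  signs-signature []               = refl
  signs-signature (inj₁ _ ∷ w)     = signs-signature w
  signs-signature (inj₂ plus ∷ w)  =
    trans (one-more-plus (+ signs plus w) (+ signs minus w)) (cong ℤ.suc (signs-signature w))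
  signs-signature (inj₂ minus ∷ w) =
    trans (one-more-minus (+ signs plus w) (+ signs minus w)) (cong ℤ.pred (signs-signature w))

  sign-difference : ∀ (v : Code N) → + #sign plus v - + #sign minus v ≡ signature v
  sign-difference v =
    trans (cong₂ (λ a b → + a - + b) (#sign≡signs plus) (#sign≡signs minus)) (signs-signature v)
    where
    #sign≡signs : ∀ s → #sign s v ≡ signs s v
    #sign≡signs s = count-lookup (λ y → ≡-dec _≟ᶠ_ _≟ˢ_ y (inj₂ s)) v

  noDemand : Demand
  noDemand _ = nothing

  involution⇒consistent : ∀ (v : Code N) → IsInvolutionCode v → Consistent 0 noDemand v
  involution⇒consistent v inv k x v[k]≡x with at-index v k v[k]≡x
  ... | i , i≡k , v[i]≡x = fits x v[i]≡x
    where
    i≡k+0 : toℕ i ≡ k + 0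
    i≡k+0 = trans i≡k (sym (+-identityʳ k))
    fits : ∀ x → lookup v i ≡ x → Fits 0 noDemand v (k + 0) x
    fits (inj₂ s) _ = signed s refl refl
    fits (inj₁ j) v[i]≡j with inv i j v[i]≡j
    ... | j≢i , v[j]≡i =
      paired refl (partner j (toℕ j) refl (sym (+-identityʳ _)) (λ j≡k → j≢i (toℕ-injective (trans j≡k (sym i≡k+0))))
                           refl i (trans (at-lookup v j) (cong just v[j]≡i)) i≡k+0)

  consistent⇒involution : ∀ (v : Code N) → Consistent 0 noDemand v → IsInvolutionCode v
  consistent⇒involution v c i j v[i]≡j with c (toℕ i) (inj₁ j) (trans (at-lookup v i) (cong just v[i]≡j))
  ... | demanded _ () _
  ... | signed _ _ ()
  ... | paired _ (partner _ k refl j≡k+0 j≢i _ j′ v[k]≡j′ j′≡i) =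
    (λ j≡i → j≢i (trans (cong toℕ j≡i) (sym (+-identityʳ _)))) ,
    trans (just-injective (trans (sym (at-lookup v j)) (trans (cong (at v) j≡k) v[k]≡j′)))
          (cong inj₁ (toℕ-injective (trans j′≡i (+-identityʳ _))))
    where
    j≡k : toℕ j ≡ k
    j≡k = trans j≡k+0 (+-identityʳ k)

  count-signed-involutions : ∀ d {P : Pred (Code N) 0ℓ} (P? : Decidable P) →
                             P ≐ (λ v → IsInvolutionCode v × + #sign plus v - + #sign minus v ≡ d) →
                             count P? (allCodes N) ≡ invCount N d
  count-signed-involutions d P? (P⊆ , ⊆P) =
    trans (counted N 0 noDemand d P? (to-spec ∘ P⊆ , ⊆P ∘ from-spec) refl)
          (cong (λ n → invCount n d) openCount-start)
    where
    to-spec : ∀ {v} → IsInvolutionCode v × + #sign plus v - + #sign minus v ≡ d → Spec 0 noDemand d v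
    to-spec {v} (inv , sig) = involution⇒consistent v inv , trans (sym (sign-difference v)) sig
    from-spec : ∀ {v} → Spec 0 noDemand d v → IsInvolutionCode v × + #sign plus v - + #sign minus v ≡ d
    from-spec {v} (c , sig) = consistent⇒involution v c , trans (sign-difference v) sig

α≡invCount : ∀ p q → α p q ≡ invCount (p + q) (+ p - + q)
α≡invCount p q = Bridge.count-signed-involutions (p + q) (+ p - + q) (isSignedInvolution? p q) (id , id)

drop-pair : ∀ a b → (1ℤ ℤ.+ a) - (1ℤ ℤ.+ b) ≡ a - b
drop-pair = ℤ-Solver.solve-∀

corollary4p3 : ((p : ℕ) → α p 0 ≡ 1) × ((q : ℕ) → α 0 q ≡ 1)
               × ((p q : ℕ) → α (suc p) (suc q) ≡ α p (suc q) + α (suc p) q + (suc p + q) * α p q)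
corollary4p3 = only-plus , only-minus , recurrence
  where
  only-plus : (p : ℕ) → α p 0 ≡ 1
  only-plus p = trans (α≡invCount p 0) (invCount-top (p + 0))

  only-minus : (q : ℕ) → α 0 q ≡ 1
  only-minus q = trans (α≡invCount 0 q) (trans (cong (invCount q) (ℤ-+-identityˡ (- + q))) (invCount-bottom q))

  recurrence : (p q : ℕ) → α (suc p) (suc q) ≡ α p (suc q) + α (suc p) q + (suc p + q) * α p q
  recurrence p q = begin
    α (suc p) (suc q)                                ≡⟨ α≡invCount (suc p) (suc q) ⟩
    invCount (suc p + suc q) (+ suc p - + suc q)     ≡⟨ cong₂ invCount (cong suc (+-suc p q)) (drop-pair (+ p) (+ q)) ⟩
    invCount (suc n) d                               ≡⟨ invCount-suc n d ⟩
    invCount n (ℤ.pred d) + invCount n (ℤ.suc d) + n * invCount (p + q) d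
      ≡⟨ cong₂ _+_ (cong₂ _+_ (sym one-more-q) (sym one-more-p)) (cong (n *_) (sym (α≡invCount p q))) ⟩
    α p (suc q) + α (suc p) q + (suc p + q) * α p q  ∎
    where
    n : ℕ
    n = suc (p + q)
    d : ℤ
    d = + p - + q
    one-more-q : α p (suc q) ≡ invCount n (ℤ.pred d)
    one-more-q = trans (α≡invCount p (suc q)) (cong₂ invCount (+-suc p q) (one-more-minus (+ p) (+ q)))
    one-more-p : α (suc p) q ≡ invCount n (ℤ.suc d)
    one-more-p = trans (α≡invCount (suc p) q) (cong (invCount n) (one-more-plus (+ p) (+ q)))
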